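{- A natural number $n$ is $3$-prime if and only if $n$ is an augmented lucky number, i.e. if and only if either $n=1$, or $n$ is prime and $t^2-t+n$ is prime for every integer $t$ with $1\le t\le n-1$.
   Context: Natural numbers start at $1$. Let $\omega=e^{i\pi/3}$ and $\Lambda=\{m+n\omega : m,n\in\mathbb{Z}\}\subset\mathbb{C}$ the hexagonal lattice. For natural numbers $a,b,c$, the ternary product $\langle a,b,c\rangle$ is the number of points of $\Lambda$ in the closed (possibly degenerate) equiangular lattice hexagon with vertices $0$, $(a-1)$, $(a-1)+(b-1)\omega$, $(a-1)+(b-1)\omega+(c-1)\omega^2$, $(b-1)\omega+(c-1)\omega^2$, $(c-1)\omega^2$, i.e. the hexagon whose consecutive sides are parallel to $1,\omega,\omega^2,-1,-\omega,-\omega^2$ and contain $a,b,c,a,b,c$ lattice points. (Equivalently, $\langle a,b,c\rangle=ab+bc+ca-a-b-c+1$.) A natural number $n$ is called $3$-prime if the only triples $(x,y,z)$ of natural numbers with $\langle x,y,z\rangle=n$ are $(1,1,n)$ and its permutations; in particular $1$ is $3$-prime. -}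

module Defs where

open import Data.Nat using (ℕ; _+_; _*_; _∸_; _≤_; _<_)
open import Data.Nat.Primality using (Prime)
open import Data.Product using (_×_)
open import Data.Sum using (_⊎_)
open import Relation.Binary.PropositionalEquality using (_≡_)

-- Ternary product ⟨a,b,c⟩ = ab+bc+ca-a-b-c+1 (the lattice-point count of the
-- hexagon, via the closed formula given in the paper). For a,b,c ≥ 1 the
-- truncated subtraction below is exact, since ab+bc+ca+1 ≥ a+b+c.
⟨_,_,_⟩ : ℕ → ℕ → ℕ → ℕ
⟨ a , b , c ⟩ = (a * b + b * c + c * a + 1) ∸ (a + b + c)

IsTrivialTriple : ℕ → ℕ → ℕ → ℕ → Set
IsTrivialTriple n x y z =
  (x ≡ 1 × y ≡ 1 × z ≡ n) ⊎ (x ≡ 1 × y ≡ n × z ≡ 1) ⊎ (x ≡ n × y ≡ 1 × z ≡ 1)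

ThreePrime : ℕ → Set
ThreePrime n = ∀ x y z → 1 ≤ x → 1 ≤ y → 1 ≤ z → ⟨ x , y , z ⟩ ≡ n → IsTrivialTriple n x y z

AugmentedLucky : ℕ → Set
AugmentedLucky n = n ≡ 1 ⊎ (Prime n × (∀ t → 1 ≤ t → t ≤ n ∸ 1 → Prime (t * t ∸ t + n)))

module Submission where

-- Write hex a b c = ⟨ 1+a , 1+b , 1+c ⟩ = ab + bc + ca + a + b + c + 1 and
-- euler n u = u(u+1) + n, the value of t² - t + n at t = u + 1.  Everything
-- rests on the factorisation identity
--     u(u+1) + hex u b c = (u+1+b)(u+1+c),
-- so hex u b c = n  iff  euler n u = (u+1+b)(u+1+c).
--
-- Lucky ⇒ 3-prime: a non-trivial triple has a coordinate u ≥ 1 with another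
-- coordinate ≥ 1; then euler n u is a product of two factors ≥ 2 with
-- t = u+1 ≤ n-1, contradicting its primality.
-- 3-prime ⇒ lucky: ⟨ d , e , 1 ⟩ = de shows that n is prime; then euler n u
-- is prime for u < n-1 by strong induction (Rabinowitsch's argument): a divisor
-- k with 2 ≤ k ≤ u would divide the smaller prime euler n (u-k), and a
-- factorisation with both factors > u would give the non-trivial triple
-- (u+1, d-u, e-u).

open import Defs
open import Data.Nat using (ℕ; _≤_)
open import Function.Bundles using (_⇔_)

open import Data.Nat
  using (zero; suc; _+_; _*_; _∸_; _<_; z≤n; s≤s; z<s; pred; _≤?_; n>1⇒nonTrivial; nonTrivial⇒n>1)
open import Data.Nat.Properties
open import Data.Nat.Divisibility
  using (_∣_; divides; quotient>1; m∣n⇒n≡m*quotient; m∣m*n; ∣m+n∣m⇒∣n)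
open import Data.Nat.Primality using (Prime; prime; composite; composite⇒¬prime; prime⇒irreducible; prime⇒nonTrivial)
open import Data.Nat.Induction using (<-rec)
open import Data.Nat.Tactic.RingSolver using (solve-∀)
open import Data.Product using (_,_)
open import Data.Sum using (_⊎_; inj₁; inj₂; [_,_]′; map₁)
open import Data.Empty using (⊥; ⊥-elim)
open import Relation.Nullary using (¬_; yes; no)
open import Relation.Binary.PropositionalEquality
open import Function.Bundles using (mk⇔; Equivalence)

-- The ternary product in coordinates counted from 0: hex a b c = ⟨ 1+a , 1+b , 1+c ⟩.
-- (The ring solver does not unfold hex, so identities about it are solved in
-- expanded form and read back through the definition.)
hex : ℕ → ℕ → ℕ → ℕ
hex a b c = a * b + b * c + c * a + a + b + c + 1

ternary-shift : ∀ a b c → ⟨ suc a , suc b , suc c ⟩ ≡ hex a b c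
ternary-shift a b c =
  trans (cong (_∸ (suc a + suc b + suc c)) (expand a b c))
        (m+n∸n≡m (hex a b c) (suc a + suc b + suc c))
  where
  expand : ∀ a b c → suc a * suc b + suc b * suc c + suc c * suc a + 1
                   ≡ (a * b + b * c + c * a + a + b + c + 1) + (suc a + suc b + suc c)
  expand = solve-∀

ternary-one : ∀ a b → ⟨ a , b , 1 ⟩ ≡ a * b
ternary-one a b = trans (cong (_∸ (a + b + 1)) (expand a b)) (m+n∸n≡m (a * b) (a + b + 1))
  where
  expand : ∀ a b → a * b + b * 1 + 1 * a + 1 ≡ a * b + (a + b + 1)
  expand = solve-∀

hex-rotate : ∀ a b c → hex a b c ≡ hex b c a
hex-rotate = rotate
  where
  rotate : ∀ a b c → a * b + b * c + c * a + a + b + c + 1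
                   ≡ b * c + c * a + a * b + b + c + a + 1
  rotate = solve-∀

hex-axis : ∀ c → hex 0 0 c ≡ suc c
hex-axis = axis
  where
  axis : ∀ c → 0 * 0 + 0 * c + c * 0 + 0 + 0 + c + 1 ≡ suc c
  axis = solve-∀

hex-lower : ∀ a b c → b + c + a < hex a b c
hex-lower a b c = subst (b + c + a <_) (sym (split a b c)) (m≤n+m (suc (b + c + a)) (a * b + b * c + c * a))
  where
  split : ∀ a b c → a * b + b * c + c * a + a + b + c + 1
                  ≡ (a * b + b * c + c * a) + suc (b + c + a)
  split = solve-∀

-- Euler's polynomial t² - t + n at t = u + 1, free of truncated subtraction.
euler : ℕ → ℕ → ℕ
euler n u = u * suc u + n

euler-value : ∀ n u → suc u * suc u ∸ suc u + n ≡ euler n u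
euler-value n u = cong (_+ n) (m+n∸m≡n (suc u) (u * suc u))

n≤euler : ∀ n u → n ≤ euler n u
n≤euler n u = m≤n+m n (u * suc u)

euler-shift : ∀ n u k → euler n (u + k) ≡ k * (u + u + k + 1) + euler n u
euler-shift = shift
  where
  shift : ∀ n u k → (u + k) * suc (u + k) + n ≡ k * (u + u + k + 1) + (u * suc u + n)
  shift = solve-∀

hex≡n⇔euler≡product : ∀ n u b c → hex u b c ≡ n ⇔ euler n u ≡ (suc u + b) * (suc u + c)
hex≡n⇔euler≡product n u b c = mk⇔
  (λ hex≡n → trans (cong (u * suc u +_) (sym hex≡n)) (factor u b c))
  (λ eq → +-cancelˡ-≡ (u * suc u) (hex u b c) n (trans (factor u b c) (sym eq)))
  where
  factor : ∀ u b c → u * suc u + (u * b + b * c + c * u + u + b + c + 1)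
                   ≡ (suc u + b) * (suc u + c)
  factor = solve-∀

record Factorisation (m : ℕ) : Set where
  constructor factorisation
  field
    {left right} : ℕ
    left≥2       : 2 ≤ left
    right≥2      : 2 ≤ right
    product      : left * right ≡ m

factorisation⇒¬prime : ∀ {m} → Factorisation m → ¬ Prime m
factorisation⇒¬prime (factorisation {d} {e} (s≤s (s≤s _)) e≥2 refl) =
  composite⇒¬prime (composite (m<m*n d e e≥2) (m∣m*n e))

prime-byFactorisation : ∀ {m} → 1 < m → ¬ Factorisation m → Prime m
prime-byFactorisation 1<m noFactorisation = prime {{n>1⇒nonTrivial 1<m}} λ where
  (composite {d} d<m d∣m) → noFactorisation
    (factorisation (nonTrivial⇒n>1 d) (quotient>1 d∣m d<m) (sym (m∣n⇒n≡m*quotient d∣m)))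

trivial-first : ∀ {n x y z} → IsTrivialTriple n x y z → x ≡ 1 ⊎ x ≡ n
trivial-first (inj₁ (x≡1 , _))        = inj₁ x≡1
trivial-first (inj₂ (inj₁ (x≡1 , _))) = inj₁ x≡1
trivial-first (inj₂ (inj₂ (x≡n , _))) = inj₂ x≡n

trivial-withOne : ∀ {n x y} → IsTrivialTriple n x y 1 → x ≡ 1 ⊎ y ≡ 1
trivial-withOne (inj₁ (x≡1 , _))            = inj₁ x≡1
trivial-withOne (inj₂ (inj₁ (x≡1 , _)))     = inj₁ x≡1
trivial-withOne (inj₂ (inj₂ (_ , y≡1 , _))) = inj₂ y≡1

-- A 3-prime n > 1 is prime: a factorisation n = d * e gives the triple (d, e, 1).
threePrime⇒prime : ∀ {n} → ThreePrime n → 1 < n → Prime n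
threePrime⇒prime {n} threePrime 1<n = prime-byFactorisation 1<n noFactorisation
  where
  noFactorisation : ¬ Factorisation n
  noFactorisation (factorisation {d} {e} d≥2 e≥2 de≡n) =
    [ (λ d≡1 → <⇒≢ d≥2 (sym d≡1)) , (λ e≡1 → <⇒≢ e≥2 (sym e≡1)) ]′
      (trivial-withOne (threePrime d e 1 (<⇒≤ d≥2) (<⇒≤ e≥2) ≤-refl
                                    (trans (ternary-one d e) de≡n)))

-- Rabinowitsch's descent: if euler n v is prime for all v < u, where u < n,
-- then every divisor k ≥ 2 of euler n u exceeds u.  Otherwise k divides
-- euler n (u-k), a prime larger than k.
divisors-exceed : ∀ {n u k} → (∀ {v} → v < u → Prime (euler n v)) → u < n →
                  2 ≤ k → k ∣ euler n u → u < k
divisors-exceed {n} {u} {k} primeBelow u<n k≥2 k∣Fu with k ≤? u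
... | no k≰u  = ≰⇒> k≰u
... | yes k≤u = ⊥-elim ([ (λ k≡1 → <⇒≢ k≥2 (sym k≡1)) , <⇒≢ k<Fv ]′
                          (prime⇒irreducible (primeBelow v<u) k∣Fv))
  where
  v : ℕ
  v = u ∸ k
  v+k≡u : v + k ≡ u
  v+k≡u = m∸n+n≡m k≤u
  v<u : v < u
  v<u = subst (v <_) v+k≡u (m<m+n v (<-trans z<s k≥2))
  k∣Fv : k ∣ euler n v
  k∣Fv = ∣m+n∣m⇒∣n (subst (k ∣_) (trans (cong (euler n) (sym v+k≡u)) (euler-shift n v k)) k∣Fu)
                   (m∣m*n (v + v + k + 1))
  k<Fv : k < euler n v
  k<Fv = <-≤-trans (≤-<-trans k≤u u<n) (n≤euler n v)

-- For a 3-prime n, a factorisation euler n u = d * e with both factors above u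
-- yields the triple (u+1, d-u, e-u), which must be trivial: u = 0 or u + 1 = n.
threePrime-eulerFactor : ∀ {n u d e} → ThreePrime n → euler n u ≡ d * e → u < d → u < e →
                         u ≡ 0 ⊎ suc u ≡ n
threePrime-eulerFactor {n} {u} {d} {e} threePrime Fu≡de u<d u<e =
  map₁ suc-injective
    (trivial-first (threePrime (suc u) (suc b) (suc c) (s≤s z≤n) (s≤s z≤n) (s≤s z≤n)
                                (trans (ternary-shift u b c) hex≡n)))
  where
  b c : ℕ
  b = d ∸ suc u
  c = e ∸ suc u
  hex≡n : hex u b c ≡ n
  hex≡n = Equivalence.from (hex≡n⇔euler≡product n u b c)
            (trans Fu≡de (sym (cong₂ _*_ (m+[n∸m]≡n u<d) (m+[n∸m]≡n u<e))))

-- For a prime 3-prime n, euler n u is prime whenever u + 1 ≤ n - 1, by strong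
-- induction on u: both factors of a factorisation exceed u, so u = 0 (and n
-- itself would factor) or u + 1 = n, both impossible.
threePrime⇒eulerPrime : ∀ {n} → ThreePrime n → Prime n → ∀ u → u < n ∸ 1 → Prime (euler n u)
threePrime⇒eulerPrime {n} threePrime n-prime = <-rec (λ u → u < n ∸ 1 → Prime (euler n u)) step
  where
  1<n : 1 < n
  1<n = nonTrivial⇒n>1 n {{prime⇒nonTrivial n-prime}}
  step : ∀ u → (∀ {v} → v < u → v < n ∸ 1 → Prime (euler n v)) → u < n ∸ 1 → Prime (euler n u)
  step u ih u<n∸1 = prime-byFactorisation (<-≤-trans 1<n (n≤euler n u)) noFactorisation
    where
    exceedsU : ∀ {k} → 2 ≤ k → k ∣ euler n u → u < k
    exceedsU = divisors-exceed (λ v<u → ih v<u (<-trans v<u u<n∸1)) (<-≤-trans u<n∸1 pred[n]≤n)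
    noFactorisation : ¬ Factorisation (euler n u)
    noFactorisation fact@(factorisation {d} {e} d≥2 e≥2 de≡Fu) =
      [ (λ u≡0 → factorisation⇒¬prime (subst (λ w → Factorisation (euler n w)) u≡0 fact) n-prime)
      , (λ su≡n → <-irrefl (cong pred su≡n) u<n∸1) ]′
      (threePrime-eulerFactor threePrime (sym de≡Fu)
        (exceedsU d≥2 (divides e (trans (sym de≡Fu) (*-comm d e))))
        (exceedsU e≥2 (divides d (sym de≡Fu))))

-- For lucky n there is no triple (2+p, 1+q, 1+r) with q + r > 0 of ternary
-- product n: it would factor euler n (1+p) into (2+p+q)(2+p+r), while
-- t = 2+p ≤ n-1 because hex dominates the sum of its arguments.
lucky⇒noWideTriple : ∀ {n} → AugmentedLucky n → ∀ p q r → 0 < q + r → hex (suc p) q r ≢ n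
lucky⇒noWideTriple {n} lucky p q r q+r>0 hex≡n = excluded lucky
  where
  t<n : 2 + p < n
  t<n = subst (2 + p <_) hex≡n (≤-<-trans (+-monoˡ-≤ (suc p) q+r>0) (hex-lower (suc p) q r))
  excluded : AugmentedLucky n → ⊥
  excluded (inj₁ n≡1)              = <⇒≢ (≤-<-trans (s≤s z≤n) t<n) (sym n≡1)
  excluded (inj₂ (_ , eulerPrime)) =
    factorisation⇒¬prime
      (factorisation (m≤m+n 2 (p + q)) (m≤m+n 2 (p + r))
                     (sym (Equivalence.to (hex≡n⇔euler≡product n (suc p) q r) hex≡n)))
      (subst Prime (euler-value n (suc p)) (eulerPrime (2 + p) (s≤s z≤n) (<⇒≤pred t<n)))

-- Lucky ⇒ 3-prime: a triple with at most one coordinate above 1 is trivial,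
-- and every other triple is excluded above (after a rotation).
lucky⇒threePrime : ∀ {n} → AugmentedLucky n → ThreePrime n
lucky⇒threePrime {n} lucky (suc a) (suc b) (suc c) _ _ _ eq =
  classify a b c (trans (sym (ternary-shift a b c)) eq)
  where
  excluded : ∀ p q r → 0 < q + r → hex (suc p) q r ≢ n
  excluded = lucky⇒noWideTriple lucky
  classify : ∀ a b c → hex a b c ≡ n → IsTrivialTriple n (suc a) (suc b) (suc c)
  classify zero    zero    c       hex≡n = inj₁ (refl , refl , trans (sym (hex-axis c)) hex≡n)
  classify zero    (suc b) zero    hex≡n = inj₂ (inj₁ (refl , sb≡n , refl))
    where
    sb≡n : suc (suc b) ≡ n
    sb≡n = trans (sym (hex-axis (suc b)))
             (trans (sym (hex-rotate (suc b) 0 0)) (trans (sym (hex-rotate 0 (suc b) 0)) hex≡n))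
  classify (suc a) zero    zero    hex≡n = inj₂ (inj₂ (sa≡n , refl , refl))
    where
    sa≡n : suc (suc a) ≡ n
    sa≡n = trans (sym (hex-axis (suc a))) (trans (sym (hex-rotate (suc a) 0 0)) hex≡n)
  classify zero    (suc b) (suc c) hex≡n =
    ⊥-elim (excluded b (suc c) 0 (s≤s z≤n) (trans (sym (hex-rotate 0 (suc b) (suc c))) hex≡n))
  classify (suc a) zero    (suc c) hex≡n = ⊥-elim (excluded a 0 (suc c) (s≤s z≤n) hex≡n)
  classify (suc a) (suc b) c       hex≡n = ⊥-elim (excluded a (suc b) c (s≤s z≤n) hex≡n)

threePrime⇒lucky : ∀ {n} → 1 ≤ n → ThreePrime n → AugmentedLucky n
threePrime⇒lucky {suc zero}        _ _          = inj₁ refl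
threePrime⇒lucky {n@(suc (suc _))} _ threePrime = inj₂ (n-prime , eulerPrime)
  where
  n-prime : Prime n
  n-prime = threePrime⇒prime threePrime (s≤s (s≤s z≤n))
  eulerPrime : ∀ t → 1 ≤ t → t ≤ n ∸ 1 → Prime (t * t ∸ t + n)
  eulerPrime (suc u) _ u<n∸1 =
    subst Prime (sym (euler-value n u)) (threePrime⇒eulerPrime threePrime n-prime u u<n∸1)

mainTheorem4 : ∀ (n : ℕ) → 1 ≤ n → (ThreePrime n ⇔ AugmentedLucky n)
mainTheorem4 n 1≤n = mk⇔ (threePrime⇒lucky 1≤n) lucky⇒threePrime
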